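{- For every $m\ge 1$, there are infinitely many pairs $(n,k)$ such that $H_{n+i,k+j}$ is composite for all $i,j\in \{1,\ldots,m\}$.
   Context: Let $F_n$ denote the Fibonacci numbers ($F_0=0$, $F_1=1$, $F_{n+2}=F_{n+1}+F_n$). For positive integers $r,k$, the entries of the determinant Hosoya triangle are $H_{r,k}=\begin{vmatrix} F_{k+1} & F_{k}\\ F_{r-k+1} & F_{r-k+2}\end{vmatrix}=F_{k+1}F_{r-k+2}-F_kF_{r-k+1}=F_{k-1}F_{r-k+2}+F_{k}F_{r-k}$, where $r$ is the line and $k$ the position in the line (with $1\le k\le r$). -}

module Defs where

open import Data.Nat using (ℕ; zero; suc; _+_; _*_; _∸_)

F : ℕ → ℕ
F zero = 0
F (suc zero) = 1
F (suc (suc n)) = F (suc n) + F n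

-- Determinant Hosoya triangle entry H r k (line r, position k), 1 ≤ k ≤ r:
-- H r k = F(k+1) F(r-k+2) - F(k) F(r-k+1) = F(k-1) F(r-k+2) + F(k) F(r-k).
-- We use the (natural-number) second form; it agrees with the determinant for 1 ≤ k ≤ r.
H : ℕ → ℕ → ℕ
H r k = F (k ∸ 1) * F ((r ∸ k) + 2) + F k * F (r ∸ k)

-- If a ≥ 3 divides both k - 1 and r - k, then F a divides both summands of
-- H r k = F(k-1) F(r-k+2) + F(k) F(r-k) (since a ∣ b implies F a ∣ F b), and
-- 1 < F a < H r k, so H r k is composite. It therefore suffices to find n, k
-- such that, for each of the m² pairs (i, j), some modulus a_ij ≥ 3 divides
-- both k + j - 1 and n + i - 1; this is a system of simultaneous congruences
-- in k and in n, solvable with arbitrarily large n.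
module Submission where

open import Defs
open import Data.Nat using (ℕ; _+_; _≤_)
open import Data.Nat.Primality using (Composite)
open import Data.Product using (∃₂; _×_)

open import Data.Nat.Base
  using (zero; suc; _*_; _∸_; _<_; z≤n; s≤s; _%_; _/_; >-nonZero; n>1⇒nonTrivial)
open import Data.Nat.Properties
open import Data.Nat.Divisibility
open import Data.Nat.DivMod
open import Data.Nat.Divisibility.Core using (hasNonTrivialDivisor)
open import Data.Nat.Solver using (module +-*-Solver)
open import Data.Product using (∃; _,_)
open import Data.Sum using (inj₁; inj₂)
open import Relation.Binary.PropositionalEquality
open +-*-Solver using (solve; _:=_; _:+_; _:*_; con)

F-suc>0 : ∀ n → 0 < F (suc n)
F-suc>0 zero = s≤s z≤n
F-suc>0 (suc n) = ≤-trans (F-suc>0 n) (m≤m+n _ _)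

F≥2 : ∀ {n} → 3 ≤ n → 2 ≤ F n
F≥2 {suc (suc (suc n))} (s≤s (s≤s (s≤s _))) = +-mono-≤ (F-suc>0 (suc n)) (F-suc>0 n)

F-+ : ∀ m n → F (m + suc n) ≡ F (suc m) * F (suc n) + F m * F n
F-+ zero n = solve 2 (λ x y → x := con 1 :* x :+ con 0 :* y) refl (F (suc n)) (F n)
F-+ (suc m) n = begin
  F (suc m + suc n)                                 ≡⟨ cong F (sym (+-suc m (suc n))) ⟩
  F (m + suc (suc n))                               ≡⟨ F-+ m (suc n) ⟩
  F (suc m) * (F (suc n) + F n) + F m * F (suc n)   ≡⟨ solve 4 (λ a b c d →
                                                         a :* (c :+ d) :+ b :* c := (a :+ b) :* c :+ a :* d)
                                                         refl (F (suc m)) (F m) (F (suc n)) (F n) ⟩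
  (F (suc m) + F m) * F (suc n) + F (suc m) * F n   ∎
  where open ≡-Reasoning

F∣F[q*n] : ∀ n q → F n ∣ F (q * n)
F∣F[q*n] n zero = F n ∣0
F∣F[q*n] zero (suc q) rewrite *-zeroʳ q = ∣-refl
F∣F[q*n] (suc n) (suc q) rewrite +-comm (suc n) (q * suc n) | F-+ (q * suc n) n =
  ∣m∣n⇒∣m+n (n∣m*n (F (suc (q * suc n)))) (∣-trans (F∣F[q*n] (suc n) q) (m∣m*n (F n)))

F-mono-∣ : ∀ {m n} → m ∣ n → F m ∣ F n
F-mono-∣ {m} (divides q refl) = F∣F[q*n] m q

-- H (suc v) (suc u) unfolds to hosoya u (v ∸ u).
hosoya : ℕ → ℕ → ℕ
hosoya u d = F u * F (d + 2) + F (suc u) * F d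

F∣hosoya : ∀ {a u d} → a ∣ u → a ∣ d → F a ∣ hosoya u d
F∣hosoya {u = u} a∣u a∣d =
  ∣m∣n⇒∣m+n (∣-trans (F-mono-∣ a∣u) (m∣m*n _)) (∣-trans (F-mono-∣ a∣d) (n∣m*n (F (suc u))))

F<hosoya : ∀ {a u d} → a ∣ u → 0 < u → 0 < d → F a < hosoya u d
F<hosoya {a} {suc u} {suc d} a∣u _ _ = begin-strict
  F a                       ≤⟨ ∣⇒≤ {{>-nonZero (F-suc>0 u)}} (F-mono-∣ a∣u) ⟩
  F (suc u)                 ≤⟨ m≤m*n (F (suc u)) (F (suc d + 2)) {{>-nonZero (F-suc>0 (d + 2))}} ⟩
  F (suc u) * F (suc d + 2) <⟨ m<m+n _ (*-mono-< (F-suc>0 (suc u)) (F-suc>0 d)) ⟩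
  hosoya (suc u) (suc d)    ∎
  where open ≤-Reasoning

H-composite : ∀ {a u v} → 3 ≤ a → a ∣ u → a ∣ v → 0 < u → u < v → Composite (H (suc v) (suc u))
H-composite {a} {u} {v} 3≤a a∣u a∣v 0<u u<v =
  hasNonTrivialDivisor {{n>1⇒nonTrivial (F≥2 3≤a)}} (F<hosoya a∣u 0<u 0<d) (F∣hosoya a∣u a∣d)
  where
    0<d : 0 < v ∸ u
    0<d = m<n⇒0<n∸m u<v
    a∣d : a ∣ v ∸ u
    a∣d = ∣m+n∣m⇒∣n (subst (a ∣_) (sym (m+[n∸m]≡n (<⇒≤ u<v))) a∣v) a∣u

modulusProduct : ℕ → ℕ
modulus : ℕ → ℕ
modulusProduct zero = 1
modulusProduct (suc ℓ) = modulusProduct ℓ * modulus ℓ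
modulus ℓ = suc (modulusProduct ℓ + modulusProduct ℓ)

modulus∣modulusProduct : ∀ {ℓ L} → ℓ < L → modulus ℓ ∣ modulusProduct L
modulus∣modulusProduct {ℓ} {suc L} (s≤s ℓ≤L) with m≤n⇒m<n∨m≡n ℓ≤L
... | inj₁ ℓ<L = ∣-trans (modulus∣modulusProduct ℓ<L) (m∣m*n (modulus L))
... | inj₂ refl = n∣m*n (modulusProduct ℓ)

modulusProduct>0 : ∀ ℓ → 0 < modulusProduct ℓ
modulusProduct>0 zero = s≤s z≤n
modulusProduct>0 (suc ℓ) = *-mono-≤ (modulusProduct>0 ℓ) (s≤s z≤n)

modulus≥3 : ∀ ℓ → 3 ≤ modulus ℓ
modulus≥3 ℓ = s≤s (+-mono-≤ (modulusProduct>0 ℓ) (modulusProduct>0 ℓ))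

-- Adding a multiple of 2 P L preserves the earlier congruences, and
-- x + 2 P L (x + s L) + s L = (x + s L) · modulus L.
solveCongruences : (s : ℕ → ℕ) (L N : ℕ) →
                   ∃ λ x → N ≤ x × (∀ {ℓ} → ℓ < L → modulus ℓ ∣ x + s ℓ)
solveCongruences s zero N = N , ≤-refl , λ ()
solveCongruences s (suc L) N with solveCongruences s L N
... | x , N≤x , solves = x + Q * (x + s L) , ≤-trans N≤x (m≤m+n x _) , solves′
  where
    Q = modulusProduct L + modulusProduct L
    solves′ : ∀ {ℓ} → ℓ < suc L → modulus ℓ ∣ x + Q * (x + s L) + s ℓ
    solves′ {ℓ} (s≤s ℓ≤L) with m≤n⇒m<n∨m≡n ℓ≤L
    ... | inj₁ ℓ<L = subst (modulus ℓ ∣_)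
          (solve 4 (λ x q y t → (x :+ t) :+ q :* y := (x :+ q :* y) :+ t) refl x Q (x + s L) (s ℓ))
          (∣m∣n⇒∣m+n (solves ℓ<L)
            (∣-trans (∣m∣n⇒∣m+n (modulus∣modulusProduct ℓ<L) (modulus∣modulusProduct ℓ<L)) (m∣m*n _)))
    ... | inj₂ refl = divides (x + s L)
          (solve 3 (λ x q t → (x :+ q :* (x :+ t)) :+ t := (x :+ t) :* (con 1 :+ q)) refl x Q (s L))

pairCode : ℕ → ℕ → ℕ → ℕ
pairCode m i j = j + i * suc m

pairCode< : ∀ {m i j} → i ≤ m → j ≤ m → pairCode m i j < suc m * suc m
pairCode< {m} i≤m j≤m = +-mono-<-≤ (s≤s j≤m) (*-monoˡ-≤ (suc m) i≤m)

pairCode-% : ∀ {m} i {j} → j ≤ m → pairCode m i j % suc m ≡ j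
pairCode-% {m} i {j} j≤m = trans ([m+kn]%n≡m%n j i (suc m)) (m<n⇒m%n≡m (s≤s j≤m))

pairCode-/ : ∀ {m} i {j} → j ≤ m → pairCode m i j / suc m ≡ i
pairCode-/ {m} i {j} j≤m = trans (+-distrib-/-∣ʳ j (n∣m*n i))
  (cong₂ _+_ (m<n⇒m/n≡0 (s≤s j≤m)) (m*n/n≡m i (suc m)))

theorem3p1 : (m : ℕ) → 1 ≤ m → (N : ℕ) →
    ∃₂ λ n k → N ≤ n × 1 ≤ k × k + m ≤ n + 1 ×
      ((i j : ℕ) → 1 ≤ i → i ≤ m → 1 ≤ j → j ≤ m → Composite (H (n + i) (k + j)))
theorem3p1 m _ N with solveCongruences (_% suc m) (suc m * suc m) 0
... | K , _ , solvesK with solveCongruences (_/ suc m) (suc m * suc m) (N + (K + m))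
... | V , N+K+m≤V , solvesV =
  suc V , suc K , ≤-trans (m≤m+n N _) (≤-trans N+K+m≤V (n≤1+n V)) , s≤s z≤n ,
  s≤s (≤-trans K+m≤V (m≤m+n V 1)) , composite-entries
  where
    K+m≤V : K + m ≤ V
    K+m≤V = ≤-trans (m≤n+m (K + m) N) N+K+m≤V
    composite-entries : (i j : ℕ) → 1 ≤ i → i ≤ m → 1 ≤ j → j ≤ m →
                        Composite (H (suc V + i) (suc K + j))
    composite-entries i j 1≤i i≤m 1≤j j≤m =
      H-composite (modulus≥3 ℓ)
        (subst (λ t → modulus ℓ ∣ K + t) (pairCode-% i j≤m) (solvesK ℓ<))
        (subst (λ t → modulus ℓ ∣ V + t) (pairCode-/ i j≤m) (solvesV ℓ<))
        (≤-trans 1≤j (m≤n+m j K))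
        (≤-<-trans (≤-trans (+-monoʳ-≤ K j≤m) K+m≤V) (m<m+n V 1≤i))
      where
        ℓ = pairCode m i j
        ℓ< = pairCode< i≤m j≤m
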